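{- Let $M$ be a model of $\mathcal{T}_N$. Every definable set is a Boolean combination of simple sets. More precisely, if $A\subseteq M^n$ is definable, then there exist a finite set $I$, finite sets $I_i$ ($i\in I$), and simple sets $B_i$ and $B_{i,j}\subsetneq B_i$ ($i\in I$, $j\in I_i$) such that $A$ is the disjoint union $\bigsqcup_{i\in I}\big(B_i\setminus\bigcup_{j\in I_i}B_{i,j}\big)$.
   Context: Fix a positive integer $N$. $\mathcal{T}_N$ is the theory in the language $\{f,c_1,\dots,c_N\}$ ($f$ unary, $c_i$ constants) stating: the $c_i$ are pairwise distinct; $f$ is a bijection from $M$ onto $M\setminus\{c_1,\dots,c_N\}$; and $f^n(x)\neq x$ for all $x$ and all $n\geq1$ ($f^n$ the $n$-th iterate, $f^0$ the identity). Definable means definable with parameters. A subset of $M^n$ is simple if it is definable by a finite conjunction of formulas $x_i=f^k(x_j)$ ($1\le i,j\le n$, $k\in\mathbb{N}$) and $x_i=c$ ($c\in M$). -}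

module Defs where

open import Level using (Level; _⊔_) renaming (suc to lsuc)
open import Data.Nat using (ℕ; zero; suc)
open import Data.Fin using (Fin)
open import Data.Product using (Σ; ∃; _×_; _,_)
open import Data.Sum using (_⊎_)
open import Data.Empty using (⊥)
open import Data.List using (List)
open import Data.List.Relation.Unary.All using (All)
open import Data.Vec.Functional using (Vector; _∷_)
open import Relation.Nullary using (¬_)
open import Relation.Binary.PropositionalEquality using (_≡_; _≢_)
open import Function.Bundles using (_⇔_)

iter : ∀ {a} {A : Set a} → (A → A) → ℕ → A → A
iter f zero    x = x
iter f (suc n) x = f (iter f n x)

-- Models of T_N : structures (M, f, c_1..c_N) satisfying the axioms,
-- with equality interpreted as propositional equality.
record ModelT (N : ℕ) (ℓ : Level) : Set (lsuc ℓ) where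
  field
    M        : Set ℓ
    f        : M → M
    c        : Fin N → M
    c-inj    : ∀ i j → c i ≡ c j → i ≡ j
    f-inj    : ∀ x y → f x ≡ f y → x ≡ y
    f-image  : ∀ y → (∃ λ x → f x ≡ y) ⇔ (∀ i → y ≢ c i)
    acyclic  : ∀ x n → iter f (suc n) x ≢ x

data Term (N : ℕ) {ℓ} (P : Set ℓ) (k : ℕ) : Set ℓ where
  var : Fin k → Term N P k
  par : P → Term N P k
  con : Fin N → Term N P k
  app : Term N P k → Term N P k

data Formula (N : ℕ) {ℓ} (P : Set ℓ) : ℕ → Set ℓ where
  _≐_  : ∀ {k} → Term N P k → Term N P k → Formula N P k
  ⊥'   : ∀ {k} → Formula N P k
  ¬'   : ∀ {k} → Formula N P k → Formula N P k
  _∧'_ : ∀ {k} → Formula N P k → Formula N P k → Formula N P k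
  _∨'_ : ∀ {k} → Formula N P k → Formula N P k → Formula N P k
  ∃'   : ∀ {k} → Formula N P (suc k) → Formula N P k
  ∀'   : ∀ {k} → Formula N P (suc k) → Formula N P k

module _ {N : ℕ} {ℓ : Level} (𝓜 : ModelT N ℓ) where
  open ModelT 𝓜

  eval : ∀ {k} → Term N M k → Vector M k → M
  eval (var i) ρ = ρ i
  eval (par a) ρ = a
  eval (con i) ρ = c i
  eval (app t) ρ = f (eval t ρ)

  Sat : ∀ {k} → Formula N M k → Vector M k → Set ℓ
  Sat (t ≐ u)  ρ = eval t ρ ≡ eval u ρ
  Sat ⊥'       ρ = Level.Lift ℓ ⊥
  Sat (¬' φ)   ρ = ¬ Sat φ ρ
  Sat (φ ∧' ψ) ρ = Sat φ ρ × Sat ψ ρ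
  Sat (φ ∨' ψ) ρ = Sat φ ρ ⊎ Sat ψ ρ
  Sat (∃' φ)   ρ = Σ M λ a → Sat φ (a ∷ ρ)
  Sat (∀' φ)   ρ = (a : M) → Sat φ (a ∷ ρ)

  Definable : ∀ {n} → (Vector M n → Set ℓ) → Set ℓ
  Definable {n} A = Σ (Formula N M n) λ φ → ∀ x → A x ⇔ Sat φ x

  data SAtom (n : ℕ) : Set ℓ where
    eqf : Fin n → ℕ → Fin n → SAtom n
    eqc : Fin n → M → SAtom n

  SAtomHolds : ∀ {n} → SAtom n → Vector M n → Set ℓ
  SAtomHolds (eqf i k j) x = x i ≡ iter f k (x j)
  SAtomHolds (eqc i a)   x = x i ≡ a

  Simple : ℕ → Set ℓ
  Simple n = List (SAtom n)

  ⟦_⟧ : ∀ {n} → Simple n → Vector M n → Set ℓ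
  ⟦ L ⟧ x = All (λ α → SAtomHolds α x) L

  _⊊_ : ∀ {n} → Simple n → Simple n → Set ℓ
  B' ⊊ B = (∀ x → ⟦ B' ⟧ x → ⟦ B ⟧ x) × (∃ λ x → ⟦ B ⟧ x × ¬ ⟦ B' ⟧ x)

  IsBoolDecomp : ∀ {n} → (Vector M n → Set ℓ) → Set ℓ
  IsBoolDecomp {n} A =
    Σ ℕ λ m → Σ (Fin m → Simple n) λ B → Σ (Fin m → ℕ) λ k →
    Σ ((i : Fin m) → Fin (k i) → Simple n) λ B' →
      let Piece : Fin m → Vector M n → Set ℓ
          Piece i x = ⟦ B i ⟧ x × (∀ j → ¬ ⟦ B' i j ⟧ x)
      in (∀ i j → B' i j ⊊ B i)
       × (∀ i i' x → i ≢ i' → Piece i x → Piece i' x → ⊥)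
       × (∀ x → A x ⇔ (∃ λ i → Piece i x))

-- Call a predicate on M^n determined if it is constant on the cells (complete sign
-- conditions) of some finite list of atoms x_i = f^k(x_j), x_i = c. Atomic formulas are
-- determined and determined predicates are closed under the Boolean connectives, so the
-- point is ∃y. Within one cell, either a positive literal pins y by f^p(y) = t(x), and y is
-- substituted away at the cost of requiring t(x) ∈ im f^p, i.e. t(x) ≠ f^m(c_i) for m < p;
-- or nothing pins y, the remaining literals exclude only finitely many values of y, and M
-- is infinite (the orbit of any point is). Finally, a determined set is the disjoint union
-- of the cells it meets, and a cell is B \ ⋃ B_j with B its positive and B_j its negative
-- atoms.
module Submission where

open import Defs
open import Level using (Level; Lift; lift) renaming (suc to lsuc)
open import Data.Nat using (ℕ; zero; suc; _+_; _≤_; _<_; _⊔_; z≤n; s≤s)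
import Data.Nat.Properties as ℕ
open import Data.Fin using (Fin; zero; suc; toℕ)
open import Data.Bool using (Bool; true; false)
open import Data.Unit.Polymorphic using (⊤; tt)
open import Data.Empty using (⊥; ⊥-elim)
open import Data.Product using (∃; _×_; _,_; proj₁; proj₂; swap)
open import Data.Sum using (inj₁; inj₂)
open import Data.List using (List; []; _∷_; _++_; map; concat; concatMap; filter; length; lookup)
import Data.List as List
open import Data.List.Relation.Unary.All as All using (All; []; _∷_)
open import Data.List.Relation.Unary.All.Properties using (++⁻ˡ; ++⁻ʳ; concat⁻; map⁻; tabulate⁻)
import Data.List.Relation.Unary.All.Properties as Allₚ
open import Data.List.Relation.Unary.AllPairs as AllPairs using (AllPairs; []; _∷_)
import Data.List.Relation.Unary.AllPairs.Properties as AllPairsₚ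
open import Data.List.Relation.Unary.Any using (here; index)
open import Data.List.Relation.Unary.Any.Properties using (lookup-index)
open import Data.List.Membership.Propositional using (_∈_)
open import Data.List.Membership.Propositional.Properties
  using (∈-map⁺; ∈-map⁻; ∈-++⁺ˡ; ∈-++⁺ʳ; ∈-++⁻; ∈-filter⁺; ∈-filter⁻; ∈-lookup)
open import Data.Vec.Functional using (Vector; head; tail) renaming (_∷_ to _∷ᵛ_)
open import Function using (_∘_)
open import Function.Bundles using (_⇔_; mk⇔; Equivalence)
import Function.Properties.Equivalence as ⇔
open import Relation.Binary using (Rel; Symmetric; tri<; tri≈; tri>)
open import Relation.Binary.PropositionalEquality
  using (_≡_; _≢_; refl; sym; trans; cong; subst; module ≡-Reasoning)
open import Relation.Nullary using (¬_; Dec; yes; no)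
open import Relation.Unary using (Pred; ∁; _∩_; _∪_; ⋂; _≐′_; _⊥′_)
open import Axiom.ExcludedMiddle using (ExcludedMiddle)
open import Axiom.DoubleNegationElimination using (em⇒dne)

open Equivalence using (to; from)

AllPairs-lookup : ∀ {a r} {A : Set a} {R : Rel A r} → Symmetric R →
                  ∀ {xs} → AllPairs R xs → ∀ {i j} → i ≢ j → R (lookup xs i) (lookup xs j)
AllPairs-lookup R-sym (Rx ∷ _)  {zero}  {zero}  i≢j = ⊥-elim (i≢j refl)
AllPairs-lookup R-sym (Rx ∷ _)  {zero}  {suc j} _   = All.lookup Rx (∈-lookup j)
AllPairs-lookup R-sym (Rx ∷ _)  {suc i} {zero}  _   = R-sym (All.lookup Rx (∈-lookup i))
AllPairs-lookup R-sym (_ ∷ Rxs) {suc i} {suc j} i≢j = AllPairs-lookup R-sym Rxs (i≢j ∘ cong suc)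

injective-sequence-avoids : ∀ {a} {A : Set a} → ExcludedMiddle a → (s : ℕ → A) →
                            (∀ {m n} → s m ≡ s n → m ≡ n) →
                            (L : List A) → ∃ λ k → All (s k ≢_) L
injective-sequence-avoids em s s-inj L = let b , avoids = eventually-avoids L in b , avoids b ℕ.≤-refl
  where
  eventually-avoids : (L : List _) → ∃ λ b → ∀ k → b ≤ k → All (s k ≢_) L
  eventually-avoids [] = 0 , λ _ _ → []
  eventually-avoids (e ∷ L) with eventually-avoids L | em {∃ λ j → s j ≡ e}
  ... | b , avoids | no ∄j = b , λ k b≤k → (λ sk≡e → ∄j (k , sk≡e)) ∷ avoids k b≤k
  ... | b , avoids | yes (j , sj≡e) = suc j ⊔ b , λ k ≤k →
    (λ sk≡e → ℕ.<-irrefl (s-inj (trans sj≡e (sym sk≡e))) (ℕ.m⊔n≤o⇒m≤o (suc j) b ≤k))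
    ∷ avoids k (ℕ.m⊔n≤o⇒n≤o (suc j) b ≤k)

Signed : ∀ {a} → Bool → Set a → Set a
Signed true  P = P
Signed false P = ¬ P

Signed-cong : ∀ {a} b {P Q : Set a} → P ⇔ Q → Signed b P ⇔ Signed b Q
Signed-cong true  P⇔Q = P⇔Q
Signed-cong false P⇔Q = mk⇔ (λ ¬P Q → ¬P (from P⇔Q Q)) (λ ¬Q P → ¬Q (to P⇔Q P))

module _ {a} {A : Set a} (f : A → A) where

  iter-+ : ∀ m n x → iter f (m + n) x ≡ iter f m (iter f n x)
  iter-+ zero    n x = refl
  iter-+ (suc m) n x = cong f (iter-+ m n x)

  iter-comm : ∀ m n x → iter f m (iter f n x) ≡ iter f n (iter f m x)
  iter-comm m n x = trans (sym (iter-+ m n x))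
                          (trans (cong (λ k → iter f k x) (ℕ.+-comm m n)) (iter-+ n m x))

  iter-injective : (∀ x y → f x ≡ f y → x ≡ y) →
                   ∀ k {x y} → iter f k x ≡ iter f k y → x ≡ y
  iter-injective f-inj zero    e = e
  iter-injective f-inj (suc k) e = iter-injective f-inj k (f-inj _ _ e)

module SignConditions {a} {X At : Set a} (holds : At → X → Set a) where

  Agree : List At → X → X → Set a
  Agree S x y = All (λ α → (holds α x → holds α y) × (holds α y → holds α x)) S

  DeterminedBy : List At → Pred X a → Set a
  DeterminedBy S P = ∀ x y → Agree S x y → P x → P y

  Determined : Pred X a → Set a
  Determined P = ∃ λ S → DeterminedBy S P

  constant-determined : ∀ {P : Pred X a} → (∀ x y → P x → P y) → Determined P
  constant-determined P-const = [] , λ x y _ → P-const x y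

  ∁-determined : ∀ {P : Pred X a} → Determined P → Determined (∁ P)
  ∁-determined (S , P-by) = S , λ x y xy ¬Px Py → ¬Px (P-by y x (All.map swap xy) Py)

  module _ {P Q : Pred X a} where

    determined-resp-≐ : P ≐′ Q → Determined P → Determined Q
    determined-resp-≐ (P⊆Q , Q⊆P) (S , P-by) = S , λ x y xy Qx → P⊆Q y (P-by x y xy (Q⊆P x Qx))

    ∩-determined : Determined P → Determined Q → Determined (P ∩ Q)
    ∩-determined (S , P-by) (S′ , Q-by) =
      S ++ S′ , λ x y xy (Px , Qx) → P-by x y (++⁻ˡ S xy) Px , Q-by x y (++⁻ʳ S xy) Qx

    ∪-determined : Determined P → Determined Q → Determined (P ∪ Q)
    ∪-determined (S , P-by) (S′ , Q-by) = S ++ S′ , λ where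
      x y xy (inj₁ Px) → inj₁ (P-by x y (++⁻ˡ S xy) Px)
      x y xy (inj₂ Qx) → inj₂ (Q-by x y (++⁻ʳ S xy) Qx)

  holds-determined : ∀ α → Determined (holds α)
  holds-determined α = α ∷ [] , λ { x y ((αx⇒αy , _) ∷ []) → αx⇒αy }

  ⋂-determined : ∀ {k} {P : Fin k → Pred X a} →
                 (∀ i → Determined (P i)) → Determined (⋂ (Fin k) P)
  ⋂-determined P-det = concat (List.tabulate (proj₁ ∘ P-det)) , λ x y xy Px i →
    proj₂ (P-det i) x y (tabulate⁻ (concat⁻ xy) i) (Px i)

  Literal : Set a
  Literal = Bool × At

  Signed-determined : ∀ b {P : Pred X a} → Determined P → Determined (Signed b ∘ P)
  Signed-determined true  P-det = P-det
  Signed-determined false P-det = ∁-determined P-det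

  LiteralHolds : Literal → Pred X a
  LiteralHolds (b , α) x = Signed b (holds α x)

  Cell : List Literal → Pred X a
  Cell T x = All (λ l → LiteralHolds l x) T

  data SignCondition : List At → List Literal → Set a where
    []  : SignCondition [] []
    _∷_ : ∀ {α S T} b → SignCondition S T → SignCondition (α ∷ S) ((b , α) ∷ T)

  signConditions : List At → List (List Literal)
  signConditions []      = [] ∷ []
  signConditions (α ∷ S) =
    map ((true , α) ∷_) (signConditions S) ++ map ((false , α) ∷_) (signConditions S)

  ∈-signConditions⁺ : ∀ {S T} → SignCondition S T → T ∈ signConditions S
  ∈-signConditions⁺ []                   = here refl
  ∈-signConditions⁺ (true ∷ ST)          = ∈-++⁺ˡ (∈-map⁺ _ (∈-signConditions⁺ ST))
  ∈-signConditions⁺ {α ∷ S} (false ∷ ST) =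
    ∈-++⁺ʳ (map ((true , α) ∷_) (signConditions S)) (∈-map⁺ _ (∈-signConditions⁺ ST))

  ∈-signConditions⁻ : ∀ S {T} → T ∈ signConditions S → SignCondition S T
  ∈-signConditions⁻ [] (here refl) = []
  ∈-signConditions⁻ (α ∷ S) T∈ with ∈-++⁻ (map ((true , α) ∷_) (signConditions S)) T∈
  ... | inj₁ T∈₁ with ∈-map⁻ _ T∈₁
  ...   | _ , T′∈ , refl = true ∷ ∈-signConditions⁻ S T′∈
  ∈-signConditions⁻ (α ∷ S) T∈ | inj₂ T∈₂ with ∈-map⁻ _ T∈₂
  ...   | _ , T′∈ , refl = false ∷ ∈-signConditions⁻ S T′∈

  cell-of : ExcludedMiddle a → ∀ S x → ∃ λ T → T ∈ signConditions S × Cell T x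
  cell-of em S x = let T , ST , Tx = go S in T , ∈-signConditions⁺ ST , Tx
    where
    go : ∀ S → ∃ λ T → SignCondition S T × Cell T x
    go [] = [] , [] , []
    go (α ∷ S) with go S | em {holds α x}
    ... | T , ST , Tx | yes αx = (true , α) ∷ T , true ∷ ST , αx ∷ Tx
    ... | T , ST , Tx | no ¬αx = (false , α) ∷ T , false ∷ ST , ¬αx ∷ Tx

  same-cell⇒agree : ∀ {S T x y} → T ∈ signConditions S → Cell T x → Cell T y → Agree S x y
  same-cell⇒agree {S} T∈ = go (∈-signConditions⁻ S T∈)
    where
    go : ∀ {S T x y} → SignCondition S T → Cell T x → Cell T y → Agree S x y
    go []           []         []         = []
    go (true ∷ ST)  (αx ∷ Tx)  (αy ∷ Ty)  = ((λ _ → αy) , (λ _ → αx)) ∷ go ST Tx Ty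
    go (false ∷ ST) (¬αx ∷ Tx) (¬αy ∷ Ty) = (⊥-elim ∘ ¬αx , ⊥-elim ∘ ¬αy)  ∷ go ST Tx Ty

  signConditions-disjoint : ∀ S → AllPairs (λ T T′ → Cell T ⊥′ Cell T′) (signConditions S)
  signConditions-disjoint []      = [] ∷ []
  signConditions-disjoint (α ∷ S) =
    AllPairsₚ.++⁺ (AllPairsₚ.map⁺ (AllPairs.map tails-disjoint (signConditions-disjoint S)))
                  (AllPairsₚ.map⁺ (AllPairs.map tails-disjoint (signConditions-disjoint S)))
                  (Allₚ.map⁺ (All.universal (λ T →
                    Allₚ.map⁺ (All.universal (opposite-heads T) _)) _))
    where
    tails-disjoint : ∀ {l T T′} → Cell T ⊥′ Cell T′ → Cell (l ∷ T) ⊥′ Cell (l ∷ T′)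
    tails-disjoint T⊥T′ x (_ ∷ Tx , _ ∷ T′x) = T⊥T′ x (Tx , T′x)
    opposite-heads : ∀ T T′ → Cell ((true , α) ∷ T) ⊥′ Cell ((false , α) ∷ T′)
    opposite-heads _ _ x (αx ∷ _ , ¬αx ∷ _) = ¬αx αx

  cell-decomposition : ExcludedMiddle a → ∀ {S P} → DeterminedBy S P →
    ∃ λ Ts → AllPairs (λ T T′ → Cell T ⊥′ Cell T′) Ts × All (λ T → ∃ (Cell T)) Ts
           × (∀ x → P x ⇔ ∃ λ i → Cell (lookup Ts i) x)
  cell-decomposition em {S} {P} P-by =
    Ts , AllPairsₚ.filter⁺ meets? (signConditions-disjoint S)
       , All.tabulate (λ T∈ → let _ , x , Tx , _ = ∈-filter⁻ meets? {xs = signConditions S} T∈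
                              in x , Tx)
       , λ x → mk⇔ (into x) (out-of x)
    where
    Meets : Pred (List Literal) a
    Meets T = ∃ λ x → Cell T x × P x
    meets? : ∀ T → Dec (Meets T)
    meets? T = em
    Ts : List (List Literal)
    Ts = filter meets? (signConditions S)
    into : ∀ x → P x → ∃ λ i → Cell (lookup Ts i) x
    into x Px = let T , T∈ , Tx = cell-of em S x
                    T∈Ts = ∈-filter⁺ meets? T∈ (x , Tx , Px)
                in index T∈Ts , subst (λ T → Cell T x) (lookup-index T∈Ts) Tx
    out-of : ∀ x → (∃ λ i → Cell (lookup Ts i) x) → P x
    out-of x (i , Tx) with ∈-filter⁻ meets? {xs = signConditions S} (∈-lookup {xs = Ts} i)
    ... | T∈ , z , Tz , Pz = P-by z x (same-cell⇒agree T∈ Tz Tx) Pz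

  ⋀ : List At → Pred X a
  ⋀ L x = All (λ α → holds α x) L

  positives negatives : List Literal → List At
  positives []                = []
  positives ((true  , α) ∷ T) = α ∷ positives T
  positives ((false , α) ∷ T) = positives T
  negatives []                = []
  negatives ((true  , α) ∷ T) = negatives T
  negatives ((false , α) ∷ T) = α ∷ negatives T

  Piece : List Literal → Pred X a
  Piece T x = ⋀ (positives T) x × (∀ j → ¬ ⋀ (lookup (negatives T) j ∷ positives T) x)

  cell⇒piece : ∀ T {x} → Cell T x → Piece T x
  cell⇒piece []                []          = [] , λ ()
  cell⇒piece ((true  , α) ∷ T) (αx ∷ Tx)   = let pos , neg = cell⇒piece T Tx in
    αx ∷ pos , λ { j (βx ∷ _ ∷ posx) → neg j (βx ∷ posx) }
  cell⇒piece ((false , α) ∷ T) (¬αx ∷ Tx)  = let pos , neg = cell⇒piece T Tx in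
    pos , λ { zero (αx ∷ _) → ¬αx αx ; (suc j) → neg j }

  piece⇒cell : ∀ T {x} → Piece T x → Cell T x
  piece⇒cell []                _                = []
  piece⇒cell ((true  , α) ∷ T) (αx ∷ pos , neg) =
    αx ∷ piece⇒cell T (pos , λ { j (βx ∷ posx) → neg j (βx ∷ αx ∷ posx) })
  piece⇒cell ((false , α) ∷ T) (pos , neg)      =
    (λ αx → neg zero (αx ∷ pos)) ∷ piece⇒cell T (pos , neg ∘ suc)

module _ {ℓ : Level} (em : ExcludedMiddle ℓ) {N : ℕ} (𝓜 : ModelT N ℓ) where
  open ModelT 𝓜
  open module Atoms {n : ℕ} = SignConditions (SAtomHolds 𝓜 {n})

  V : ℕ → Set ℓ
  V = Vector M

  f^-injective : ∀ k {x y} → iter f k x ≡ iter f k y → x ≡ y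
  f^-injective = iter-injective f f-inj

  orbit-never-returns : ∀ x {m n} → m < n → iter f m x ≢ iter f n x
  orbit-never-returns x {m} m<n e with ℕ.m≤n⇒∃[o]m+o≡n m<n
  ... | o , refl = acyclic x o (sym (f^-injective m (begin
    iter f m x                  ≡⟨ e ⟩
    iter f (suc m + o) x        ≡⟨ cong (λ k → iter f k x) (sym (ℕ.+-suc m o)) ⟩
    iter f (m + suc o) x        ≡⟨ iter-+ f m (suc o) x ⟩
    iter f m (iter f (suc o) x) ∎)))
    where open ≡-Reasoning

  orbit-injective : ∀ x {m n} → iter f m x ≡ iter f n x → m ≡ n
  orbit-injective x {m} {n} e with ℕ.<-cmp m n
  ... | tri< m<n _ _ = ⊥-elim (orbit-never-returns x m<n e)
  ... | tri≈ _ m≡n _ = m≡n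
  ... | tri> _ _ n<m = ⊥-elim (orbit-never-returns x n<m (sym e))

  M-infinite : M → (L : List M) → ∃ λ y → All (y ≢_) L
  M-infinite x L =
    let k , avoids = injective-sequence-avoids em (λ k → iter f k x) (orbit-injective x) L
    in iter f k x , avoids

  c∉image : ∀ x i → f x ≢ c i
  c∉image x i e = to (f-image (c i)) (x , e) i refl

  AvoidsConstantOrbits : ℕ → M → Set ℓ
  AvoidsConstantOrbits p w = ∀ (m : Fin p) i → w ≢ iter f (toℕ m) (c i)

  iter-image : ∀ p w → (∃ λ y → iter f p y ≡ w) ⇔ AvoidsConstantOrbits p w
  iter-image zero    w = mk⇔ (λ _ ()) (λ _ → w , refl)
  iter-image (suc p) w = mk⇔ into out-of
    where
    into : (∃ λ y → iter f (suc p) y ≡ w) → AvoidsConstantOrbits (suc p) w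
    into (y , refl) zero    i = c∉image _ i
    into (y , refl) (suc m) i = to (iter-image p _) (y , refl) m i ∘ f-inj _ _
    out-of : AvoidsConstantOrbits (suc p) w → ∃ λ y → iter f (suc p) y ≡ w
    out-of w∉ = let v , fv≡w = from (f-image w) (w∉ zero)
                    y , fᵖy≡v = from (iter-image p v) λ m i v≡ →
                                  w∉ (suc m) i (trans (sym fv≡w) (cong f v≡))
                in y , trans (cong f fᵖy≡v) fv≡w

  data NormalTerm (n : ℕ) : Set ℓ where
    var   : ℕ → Fin n → NormalTerm n
    point : M → NormalTerm n

  evalN : ∀ {n} → NormalTerm n → V n → M
  evalN (var k j) x = iter f k (x j)
  evalN (point a) x = a

  shift : ∀ {n} → ℕ → NormalTerm n → NormalTerm n
  shift p (var k j) = var (p + k) j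
  shift p (point a) = point (iter f p a)

  evalN-shift : ∀ {n} p (u : NormalTerm n) x → evalN (shift p u) x ≡ iter f p (evalN u x)
  evalN-shift p (var k j) x = iter-+ f p k (x j)
  evalN-shift p (point a) x = refl

  normalise : ∀ {n} → Term N M n → NormalTerm n
  normalise (var i) = var 0 i
  normalise (par a) = point a
  normalise (con i) = point (c i)
  normalise (app t) = shift 1 (normalise t)

  eval-normalise : ∀ {n} (t : Term N M n) x → eval 𝓜 t x ≡ evalN (normalise t) x
  eval-normalise (var i) x = refl
  eval-normalise (par a) x = refl
  eval-normalise (con i) x = refl
  eval-normalise (app t) x = trans (cong f (eval-normalise t x)) (sym (evalN-shift 1 (normalise t) x))

  Equation : ∀ {n} → NormalTerm n → NormalTerm n → Pred (V n) ℓ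
  Equation u v x = evalN u x ≡ evalN v x

  equation-sym-determined : ∀ {n} (u v : NormalTerm n) →
                            Determined (Equation u v) → Determined (Equation v u)
  equation-sym-determined u v = determined-resp-≐ ((λ _ → sym) , (λ _ → sym))

  vars-equation-determined : ∀ {n} k d (i j : Fin n) → Determined (Equation (var k i) (var (k + d) j))
  vars-equation-determined k d i j = determined-resp-≐
    ((λ x xi≡ → trans (cong (iter f k) xi≡) (sym (iter-+ f k d (x j))))
    , (λ x e → f^-injective k (trans e (iter-+ f k d (x j)))))
    (holds-determined (eqf i d j))

  var-point-determined : ∀ {n} k (i : Fin n) a → Determined (Equation (var k i) (point a))
  var-point-determined k i a with em {∃ λ w → iter f k w ≡ a}
  ... | yes (w , fᵏw≡a) = determined-resp-≐
    ( (λ x xi≡w → trans (cong (iter f k) xi≡w) fᵏw≡a)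
    , (λ x e → f^-injective k (trans e (sym fᵏw≡a))))
    (holds-determined (eqc i w))
  ... | no ∄w = constant-determined (λ x _ e → ⊥-elim (∄w (x i , e)))

  equation-determined : ∀ {n} (u v : NormalTerm n) → Determined (Equation u v)
  equation-determined (var k i) (var m j) with ℕ.≤-total k m
  ... | inj₁ k≤m = let d , k+d≡m = ℕ.m≤n⇒∃[o]m+o≡n k≤m in
    subst (λ m → Determined (Equation (var k i) (var m j))) k+d≡m (vars-equation-determined k d i j)
  ... | inj₂ m≤k = let d , m+d≡k = ℕ.m≤n⇒∃[o]m+o≡n m≤k in
    equation-sym-determined (var m j) (var k i)
      (subst (λ k → Determined (Equation (var m j) (var k i))) m+d≡k (vars-equation-determined m d j i))
  equation-determined (var k i) (point a) = var-point-determined k i a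
  equation-determined (point a) (var k i) =
    equation-sym-determined (var k i) (point a) (var-point-determined k i a)
  equation-determined (point a) (point b) = constant-determined (λ _ _ e → e)

  Lit : ℕ → Set ℓ
  Lit n = Literal {n}

  ∃ᵛ : ∀ {n} → Pred (V (suc n)) ℓ → Pred (V n) ℓ
  ∃ᵛ P x = ∃ λ y → P (y ∷ᵛ x)

  PinnedBy : ∀ {n} → ℕ → NormalTerm n → Pred (V (suc n)) ℓ
  PinnedBy p t z = iter f p (head z) ≡ evalN t (tail z)

  image-determined : ∀ {n} p (t : NormalTerm n) → Determined (∃ᵛ (PinnedBy p t))
  image-determined p t = determined-resp-≐
    ((λ x → from (iter-image p (evalN t x))) , (λ x → to (iter-image p (evalN t x))))
    (⋂-determined λ m → ⋂-determined λ i →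
      ∁-determined (equation-determined t (point (iter f (toℕ m) (c i)))))

  data Shape {n} (α : SAtom 𝓜 (suc n)) : Set (lsuc ℓ) where
    y-free : (Q : Pred (V n) ℓ) → Determined Q →
             (∀ z → SAtomHolds 𝓜 α z ⇔ Q (tail z)) → Shape α
    y-pin  : ∀ p t → (∀ z → SAtomHolds 𝓜 α z ⇔ PinnedBy p t z) → Shape α

  shape : ∀ {n} (α : SAtom 𝓜 (suc n)) → Shape α
  shape (eqf zero m zero)       = y-free (λ _ → Lift ℓ (m ≡ 0)) (constant-determined λ _ _ m≡0 → m≡0) λ z →
    mk⇔ (λ y≡fᵐy → lift (sym (orbit-injective (head z) y≡fᵐy))) (λ { (lift refl) → refl })
  shape (eqf zero m (suc j))    = y-pin 0 (var m j) λ _ → ⇔.refl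
  shape (eqf (suc i) m zero)    = y-pin m (var 0 i) λ _ → mk⇔ sym sym
  shape (eqf (suc i) m (suc j)) = y-free _ (holds-determined (eqf i m j)) λ _ → ⇔.refl
  shape (eqc zero a)            = y-pin 0 (point a) λ _ → ⇔.refl
  shape (eqc (suc i) a)         = y-free _ (holds-determined (eqc i a)) λ _ → ⇔.refl

  record PinnedElimination {n} p (t : NormalTerm n) (P : Pred (V (suc n)) ℓ) : Set (lsuc ℓ) where
    field
      residual   : Pred (V n) ℓ
      determined : Determined residual
      reduces    : ∀ z → PinnedBy p t z → P z ⇔ residual (tail z)

  pin-transfer : ∀ {n} p (t : NormalTerm n) q s z → PinnedBy p t z →
                 PinnedBy q s z ⇔ Equation (shift q t) (shift p s) (tail z)
  pin-transfer p t q s z fᵖy≡t = mk⇔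
    (λ fᵠy≡s → begin
      evalN (shift q t) x   ≡⟨ evalN-shift q t x ⟩
      iter f q (evalN t x)  ≡⟨ cong (iter f q) fᵖy≡t ⟨
      iter f q (iter f p y) ≡⟨ iter-comm f q p y ⟩
      iter f p (iter f q y) ≡⟨ cong (iter f p) fᵠy≡s ⟩
      iter f p (evalN s x)  ≡⟨ evalN-shift p s x ⟨
      evalN (shift p s) x   ∎)
    (λ e → f^-injective p (begin
      iter f p (iter f q y) ≡⟨ iter-comm f p q y ⟩
      iter f q (iter f p y) ≡⟨ cong (iter f q) fᵖy≡t ⟩
      iter f q (evalN t x)  ≡⟨ evalN-shift q t x ⟨
      evalN (shift q t) x   ≡⟨ e ⟩
      evalN (shift p s) x   ≡⟨ evalN-shift p s x ⟩
      iter f p (evalN s x)  ∎))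
    where
    open ≡-Reasoning
    y = head z
    x = tail z

  pinned-literal : ∀ {n} p (t : NormalTerm n) b {α} →
                   Shape α → PinnedElimination p t (LiteralHolds (b , α))
  pinned-literal p t b (y-free Q Q-det α⇔Q) = record
    { residual   = Signed b ∘ Q
    ; determined = Signed-determined b Q-det
    ; reduces    = λ z _ → Signed-cong b (α⇔Q z) }
  pinned-literal p t b (y-pin q s α⇔pin) = record
    { residual   = Signed b ∘ Equation (shift q t) (shift p s)
    ; determined = Signed-determined b (equation-determined (shift q t) (shift p s))
    ; reduces    = λ z fᵖy≡t →
        Signed-cong b (⇔.trans (α⇔pin z) (pin-transfer p t q s z fᵖy≡t)) }

  pinned-cell : ∀ {n} p (t : NormalTerm n) (T : List (Lit (suc n))) → PinnedElimination p t (Cell T)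
  pinned-cell p t [] = record
    { residual   = λ _ → ⊤
    ; determined = constant-determined λ _ _ _ → tt
    ; reduces    = λ _ _ → mk⇔ (λ _ → tt) (λ _ → []) }
  pinned-cell p t ((b , α) ∷ T) = record
    { residual   = L.residual ∩ R.residual
    ; determined = ∩-determined L.determined R.determined
    ; reduces    = λ z pin → mk⇔
        (λ { (l ∷ r) → to (L.reduces z pin) l , to (R.reduces z pin) r })
        (λ (l , r) → from (L.reduces z pin) l ∷ from (R.reduces z pin) r) }
    where
    module L = PinnedElimination (pinned-literal p t b (shape α))
    module R = PinnedElimination (pinned-cell p t T)

  pinned-∃-determined : ∀ {n} (T : List (Lit (suc n))) p t → (∀ z → Cell T z → PinnedBy p t z) →
                        Determined (∃ᵛ (Cell T))
  pinned-∃-determined T p t pinned = determined-resp-≐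
    ( (λ x ((y , pin) , r) → y , from (reduces (y ∷ᵛ x) pin) r)
    , (λ x (y , Tyx) → (y , pinned _ Tyx) , to (reduces (y ∷ᵛ x) (pinned _ Tyx)) Tyx))
    (∩-determined (image-determined p t) determined)
    where open PinnedElimination (pinned-cell p t T)

  preimage-candidates : ∀ p w → Dec (∃ λ y → iter f p y ≡ w) → List M
  preimage-candidates p w (yes (y , _)) = y ∷ []
  preimage-candidates p w (no _)        = []

  outside-candidates : ∀ p w {y} (d : Dec (∃ λ y → iter f p y ≡ w)) →
                       All (y ≢_) (preimage-candidates p w d) → iter f p y ≢ w
  outside-candidates p w (yes (y′ , fᵖy′≡w)) (y≢y′ ∷ []) fᵖy≡w =
    y≢y′ (f^-injective p (trans fᵖy≡w (sym fᵖy′≡w)))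
  outside-candidates p w {y} (no ∄) [] fᵖy≡w = ∄ (y , fᵖy≡w)

  record FreeElimination {n} (P : Pred (V (suc n)) ℓ) : Set (lsuc ℓ) where
    field
      residual   : Pred (V n) ℓ
      determined : Determined residual
      forbidden  : V n → List M
      sound      : ∀ z → P z → residual (tail z)
      complete   : ∀ z → residual (tail z) → All (head z ≢_) (forbidden (tail z)) → P z

  y-free-literal : ∀ {n} b {α : SAtom 𝓜 (suc n)} (Q : Pred (V n) ℓ) → Determined Q →
                   (∀ z → SAtomHolds 𝓜 α z ⇔ Q (tail z)) → FreeElimination (LiteralHolds (b , α))
  y-free-literal b Q Q-det α⇔Q = record
    { residual   = Signed b ∘ Q
    ; determined = Signed-determined b Q-det
    ; forbidden  = λ _ → []
    ; sound      = λ z → to (Signed-cong b (α⇔Q z))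
    ; complete   = λ z Qz _ → from (Signed-cong b (α⇔Q z)) Qz }

  negated-pin-literal : ∀ {n} {α : SAtom 𝓜 (suc n)} p t →
                        (∀ z → SAtomHolds 𝓜 α z ⇔ PinnedBy p t z) →
                        FreeElimination (LiteralHolds (false , α))
  negated-pin-literal p t α⇔pin = record
    { residual   = λ _ → ⊤
    ; determined = constant-determined λ _ _ _ → tt
    ; forbidden  = λ x → preimage-candidates p (evalN t x) em
    ; sound      = λ _ _ → tt
    ; complete   = λ z _ avoids α →
        outside-candidates p (evalN t (tail z)) em avoids (to (α⇔pin z) α) }

  free-cell : ∀ {n} {T : List (Lit (suc n))} →
              All (FreeElimination ∘ LiteralHolds) T → FreeElimination (Cell T)
  free-cell [] = record
    { residual   = λ _ → ⊤
    ; determined = constant-determined λ _ _ _ → tt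
    ; forbidden  = λ _ → []
    ; sound      = λ _ _ → tt
    ; complete   = λ _ _ _ → [] }
  free-cell (L ∷ Ls) = record
    { residual   = L.residual ∩ R.residual
    ; determined = ∩-determined L.determined R.determined
    ; forbidden  = λ x → L.forbidden x ++ R.forbidden x
    ; sound      = λ { z (l ∷ r) → L.sound z l , R.sound z r }
    ; complete   = λ z (l , r) avoids →
        L.complete z l (++⁻ˡ (L.forbidden _) avoids)
        ∷ R.complete z r (++⁻ʳ (L.forbidden _) avoids) }
    where
    module L = FreeElimination L
    module R = FreeElimination (free-cell Ls)

  free-∃-determined : ∀ {n} {P : Pred (V (suc n)) ℓ} → M → FreeElimination P → Determined (∃ᵛ P)
  free-∃-determined m₀ P-free = determined-resp-≐
    ( (λ x r → let y , avoids = M-infinite m₀ (forbidden x) in y , complete (y ∷ᵛ x) r avoids)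
    , (λ x (y , Pyx) → sound (y ∷ᵛ x) Pyx))
    determined
    where open FreeElimination P-free

  data CellView {n} (T : List (Lit (suc n))) : Set (lsuc ℓ) where
    pinned : ∀ p t → (∀ z → Cell T z → PinnedBy p t z) → CellView T
    free   : All (FreeElimination ∘ LiteralHolds) T → CellView T

  cellView : ∀ {n} (T : List (Lit (suc n))) → CellView T
  cellView [] = free []
  cellView ((b , α) ∷ T) = cons b (shape α) (cellView T)
    where
    extend : ∀ {l} → FreeElimination (LiteralHolds l) → CellView T → CellView (l ∷ T)
    extend L (pinned p t pin) = pinned p t λ { z (_ ∷ Tz) → pin z Tz }
    extend L (free Ls)        = free (L ∷ Ls)
    cons : ∀ b → Shape α → CellView T → CellView ((b , α) ∷ T)
    cons true  (y-pin p t α⇔pin) _  = pinned p t λ { z (α ∷ _) → to (α⇔pin z) α }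
    cons false (y-pin p t α⇔pin)    = extend (negated-pin-literal p t α⇔pin)
    cons b     (y-free Q Q-det α⇔Q) = extend (y-free-literal b Q Q-det α⇔Q)

  cell-∃-determined : ∀ {n} → M → (T : List (Lit (suc n))) → Determined (∃ᵛ (Cell T))
  cell-∃-determined m₀ T with cellView T
  ... | pinned p t pin = pinned-∃-determined T p t pin
  ... | free Ls        = free-∃-determined m₀ (free-cell Ls)

  -- P is constant on each cell of S, so ∃ᵛ P is the union of the ∃ᵛ (Cell T) it meets.
  ∃-determined : ∀ {n} {P : Pred (V (suc n)) ℓ} → M → Determined P → Determined (∃ᵛ P)
  ∃-determined m₀ (S , P-by) = concatMap (proj₁ ∘ cell-∃-determined m₀) (signConditions S) ,
    λ x x′ xx′ (y , Pyx) →
      let T , T∈ , Tyx = cell-of em S (y ∷ᵛ x)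
          xx′-on-T = All.lookup (map⁻ (concat⁻ xx′)) T∈
          y′ , Ty′x′ = proj₂ (cell-∃-determined m₀ T) x x′ xx′-on-T (y , Tyx)
      in y′ , P-by (y ∷ᵛ x) (y′ ∷ᵛ x′) (same-cell⇒agree T∈ Tyx Ty′x′) Pyx

  sat-determined : ∀ {k} → M → (φ : Formula N M k) → Determined (Sat 𝓜 φ)
  sat-determined m₀ (t ≐ u) = determined-resp-≐
    ( (λ x e → trans (eval-normalise t x) (trans e (sym (eval-normalise u x))))
    , (λ x e → trans (sym (eval-normalise t x)) (trans e (eval-normalise u x))))
    (equation-determined (normalise t) (normalise u))
  sat-determined m₀ ⊥'       = constant-determined λ _ _ ()
  sat-determined m₀ (¬' φ)   = ∁-determined (sat-determined m₀ φ)
  sat-determined m₀ (φ ∧' ψ) = ∩-determined (sat-determined m₀ φ) (sat-determined m₀ ψ)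
  sat-determined m₀ (φ ∨' ψ) = ∪-determined (sat-determined m₀ φ) (sat-determined m₀ ψ)
  sat-determined m₀ (∃' φ)   = ∃-determined m₀ (sat-determined m₀ φ)
  sat-determined m₀ (∀' φ)   = determined-resp-≐
    ((λ x ∄ y → em⇒dne em λ ¬φ → ∄ (y , ¬φ)) , (λ x ∀φ (y , ¬φ) → ¬φ (∀φ y)))
    (∁-determined (∃-determined m₀ (∁-determined (sat-determined m₀ φ))))

  bool-decomposition : ∀ {n} {A : Pred (V n) ℓ} → Determined A → IsBoolDecomp 𝓜 A
  bool-decomposition {n} {A} (S , A-by) with cell-decomposition em A-by
  ... | Ts , disjoint , inhabited , A⇔cells =
    length Ts , B , length ∘ negatives ∘ Tᵢ , B′ , proper , pieces-disjoint , A⇔pieces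
    where
    Tᵢ : Fin (length Ts) → List (Lit n)
    Tᵢ = lookup Ts
    B : Fin (length Ts) → Simple 𝓜 n
    B = positives ∘ Tᵢ
    B′ : ∀ i → Fin (length (negatives (Tᵢ i))) → Simple 𝓜 n
    B′ i j = lookup (negatives (Tᵢ i)) j ∷ B i
    proper : ∀ i j → _⊊_ 𝓜 (B′ i j) (B i)
    proper i j = let z , Tz = All.lookup inhabited (∈-lookup i) ; pos , neg = cell⇒piece (Tᵢ i) Tz
                 in (λ _ → All.tail) , z , pos , neg j
    pieces-disjoint : ∀ i i′ x → i ≢ i′ → Piece (Tᵢ i) x → Piece (Tᵢ i′) x → ⊥
    pieces-disjoint i i′ x i≢i′ piece piece′ =
      AllPairs-lookup (λ T⊥T′ x (Tx , T′x) → T⊥T′ x (T′x , Tx)) disjoint i≢i′ x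
        (piece⇒cell (Tᵢ i) piece , piece⇒cell (Tᵢ i′) piece′)
    A⇔pieces : ∀ x → A x ⇔ ∃ λ i → Piece (Tᵢ i) x
    A⇔pieces x = ⇔.trans (A⇔cells x)
      (mk⇔ (λ (i , Tx)    → i , cell⇒piece (Tᵢ i) Tx)
           (λ (i , piece) → i , piece⇒cell (Tᵢ i) piece))

lemma5p1 : {ℓ : Level} → ExcludedMiddle ℓ → (N : ℕ) → 1 ≤ N → (𝓜 : ModelT N ℓ) → (n : ℕ)
    → (A : Vector (ModelT.M 𝓜) n → Set ℓ) → Definable 𝓜 A → IsBoolDecomp 𝓜 A
lemma5p1 em (suc N) (s≤s z≤n) 𝓜 n A (φ , A⇔φ) =
  bool-decomposition em 𝓜
    (determined-resp-≐ ((λ x → from (A⇔φ x)) , (λ x → to (A⇔φ x))) (sat-determined em 𝓜 (c zero) φ))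
  where
  open ModelT 𝓜 using (c)
  open SignConditions (SAtomHolds 𝓜 {n}) using (determined-resp-≐)
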